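{- Let $\phi$ be an LTL formula in negation normal form. If the propositional formula $of(\phi)$ is satisfiable, then $\phi$ is satisfiable, i.e. there is an infinite word $\xi\in(2^{AP})^\omega$ with $\xi\models\phi$.
   Context: Let $AP$ be a finite set of atomic propositions. A literal is $a$ or $\neg a$ for $a\in AP$. NNF LTL formulas are generated by $\phi ::= \mathit{tt}\mid \mathit{ff}\mid a\mid \neg a\mid \phi\wedge\phi\mid\phi\vee\phi\mid X\phi\mid \phi U\phi\mid \phi R\phi$. The abbreviations $F\psi=\mathit{tt}U\psi$ and $G\psi=\mathit{ff}R\psi$ are used. Semantics: for $\xi=\xi(0)\xi(1)\cdots\in(2^{AP})^\omega$, let $\xi_k=\xi(k)\xi(k+1)\cdots$. Then: - $\xi\models a$ iff $a\in\xi(0)$, and $\xi\models\neg a$ iff $a\notin\xi(0)$; - $\xi\models\mathit{tt}$ always holds and $\xi\models\mathit{ff}$ never holds; - $\wedge$ and $\vee$ are interpreted as usual; - $\xi\models X\phi$ iff $\xi_1\models\phi$; - $\xi\models\phi_1U\phi_2$ iff there is $i\ge0$ with $\xi_i\models\phi_2$ and $\xi_j\models\phi_1$ for all $0\le j<i$; - $\xi\models\phi_1R\phi_2$ iff either $\xi_i\models\phi_2$ for all $i\ge0$, or there is $i\ge0$ with $\xi_i\models\phi_1\wedge\phi_2$ and $\xi_j\models\phi_2$ for all $0\le j<i$. The obligation formula $of(\phi)$ is defined recursively: - $of(\mathit{tt})=\mathit{tt}$, $of(\mathit{ff})=\mathit{ff}$; - $of(p)=p$ for a literal $p$; - $of(X\psi)=of(\psi)$;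 - $of(\phi_1U\phi_2)=of(\phi_1R\phi_2)=of(\phi_2)$; - $of(\phi_1\wedge\phi_2)=of(\phi_1)\wedge of(\phi_2)$; - $of(\phi_1\vee\phi_2)=of(\phi_1)\vee of(\phi_2)$. $of(\phi)$ is read as a propositional formula over $AP$. -}

module Defs where

open import Data.Nat using (ℕ; zero; suc; _+_; _<_)
open import Data.Fin using (Fin)
open import Data.Bool using (Bool; true; false)
open import Data.Product using (_×_; Σ; ∃-syntax)
open import Data.Sum using (_⊎_)
open import Data.Unit using (⊤)
open import Data.Empty using (⊥)
open import Relation.Binary.PropositionalEquality using (_≡_)

-- NNF LTL formulas over AP = Fin n
data LTL (n : ℕ) : Set where
  tt ff : LTL n
  pos neg : Fin n → LTL n
  _∧_ _∨_ : LTL n → LTL n → LTL n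
  X : LTL n → LTL n
  _U_ _R_ : LTL n → LTL n → LTL n

-- a letter of 2^AP, represented by its characteristic function
Letter : ℕ → Set
Letter n = Fin n → Bool

Word : ℕ → Set
Word n = ℕ → Letter n

suffix : ∀ {n} → Word n → ℕ → Word n
suffix ξ k = λ i → ξ (k + i)

_⊨_ : ∀ {n} → Word n → LTL n → Set
ξ ⊨ tt = ⊤
ξ ⊨ ff = ⊥
ξ ⊨ pos a = ξ 0 a ≡ true
ξ ⊨ neg a = ξ 0 a ≡ false
ξ ⊨ (φ ∧ ψ) = (ξ ⊨ φ) × (ξ ⊨ ψ)
ξ ⊨ (φ ∨ ψ) = (ξ ⊨ φ) ⊎ (ξ ⊨ ψ)
ξ ⊨ X φ = suffix ξ 1 ⊨ φ
ξ ⊨ (φ U ψ) = ∃[ i ] ((suffix ξ i ⊨ ψ) × (∀ j → j < i → suffix ξ j ⊨ φ))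
ξ ⊨ (φ R ψ) = (∀ i → suffix ξ i ⊨ ψ)
            ⊎ (∃[ i ] ((suffix ξ i ⊨ φ) × (suffix ξ i ⊨ ψ) × (∀ j → j < i → suffix ξ j ⊨ ψ)))

F G : ∀ {n} → LTL n → LTL n
F ψ = tt U ψ
G ψ = ff R ψ

data Prop (n : ℕ) : Set where
  ptt pff : Prop n
  ppos pneg : Fin n → Prop n
  _p∧_ _p∨_ : Prop n → Prop n → Prop n

_⊨ₚ_ : ∀ {n} → (Fin n → Bool) → Prop n → Set
v ⊨ₚ ptt = ⊤
v ⊨ₚ pff = ⊥
v ⊨ₚ ppos a = v a ≡ true
v ⊨ₚ pneg a = v a ≡ false
v ⊨ₚ (p p∧ q) = (v ⊨ₚ p) × (v ⊨ₚ q)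
v ⊨ₚ (p p∨ q) = (v ⊨ₚ p) ⊎ (v ⊨ₚ q)

of : ∀ {n} → LTL n → Prop n
of tt = ptt
of ff = pff
of (pos a) = ppos a
of (neg a) = pneg a
of (φ ∧ ψ) = of φ p∧ of ψ
of (φ ∨ ψ) = of φ p∨ of ψ
of (X φ) = of φ
of (φ U ψ) = of ψ
of (φ R ψ) = of ψ

PropSatisfiable : ∀ {n} → Prop n → Set
PropSatisfiable p = ∃[ v ] (v ⊨ₚ p)

Satisfiable : ∀ {n} → LTL n → Set
Satisfiable φ = ∃[ ξ ] (ξ ⊨ φ)

-- Read a satisfying valuation v of of(φ) as the constant word v^ω. Every
-- suffix of v^ω is v^ω itself, so X φ holds iff φ does, ψ₁ U ψ₂ is fulfilled
-- at position 0 and ψ₁ R ψ₂ by ψ₂ holding everywhere; only the right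
-- arguments of U and R matter, which is exactly what of records.
module Submission where

open import Defs
open import Data.Nat using (ℕ)
open import Data.Product using (_,_)
open import Data.Sum using (inj₁; inj₂)
open import Function using (const)

constant-word-⊨ : ∀ {n} (v : Letter n) (φ : LTL n) → v ⊨ₚ of φ → const v ⊨ φ
constant-word-⊨ v tt h = h
constant-word-⊨ v (pos a) h = h
constant-word-⊨ v (neg a) h = h
constant-word-⊨ v (φ ∧ ψ) (h₁ , h₂) = constant-word-⊨ v φ h₁ , constant-word-⊨ v ψ h₂
constant-word-⊨ v (φ ∨ ψ) (inj₁ h) = inj₁ (constant-word-⊨ v φ h)
constant-word-⊨ v (φ ∨ ψ) (inj₂ h) = inj₂ (constant-word-⊨ v ψ h)
constant-word-⊨ v (X φ) h = constant-word-⊨ v φ h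
constant-word-⊨ v (φ U ψ) h = 0 , constant-word-⊨ v ψ h , λ _ ()
constant-word-⊨ v (φ R ψ) h = inj₁ (λ _ → constant-word-⊨ v ψ h)

theorem4 : (n : ℕ) (φ : LTL n) → PropSatisfiable (of φ) → Satisfiable φ
theorem4 n φ (v , v⊨ₚofφ) = const v , constant-word-⊨ v φ v⊨ₚofφ
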